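{- All rules of the calculus $\sharp{\sf S5}_n$ are sound, i.e., for every rule instance, if all premises are valid then the conclusion is valid. Hence, for every cross-sequent $\mathcal{S}$, if $\vdash_{\sharp{\sf S5}_n}\mathcal{S}$ then $\mathcal{S}$ is valid, and consequently $\iota(\mathcal{S})\in{\sf S5}_n$.
   Context: Fix a countably infinite set $\mathrm{Prop}$ of atoms and a finite nonempty set $A$ of agents, $n=|A|$. Formulas (negation normal form): $\phi::=\bot\mid\top\mid p\mid\neg p\mid(\phi\wedge\phi)\mid(\phi\vee\phi)\mid\Box_a\phi\mid\Diamond_a\phi$. An epistemic model $\mathcal{M}=(W,R,V)$ has $W\neq\varnothing$, an equivalence relation $R_a$ on $W$ for each $a\in A$, and a valuation $V:\mathrm{Prop}\to\mathcal{P}(W)$; truth is standard. ${\sf S5}_n$ is the set of formulas true at every world of every epistemic model. A sequent is a finite set of formulas. Cross-sequents/hypersequents by mutual recursion: every sequent is a cross-sequent; a hypersequent $H=\mathcal{S}_1|\dots|\mathcal{S}_m$ ($m\ge1$) is a finite multiset of cross-sequents; if $\mathcal{S}$ is a cross-sequent, $a\in A$, $H$ a hypersequent, then $\mathcal{S},[H]_a$ is a cross-sequent. A cross-sequent is a finite tree of sequents (components); the roots of members of $H$ are the $a$-children of the root of $\mathcal{S},[H]_a$ (their $a$-parent) and $a$-siblings of each other. Proper: (a) each component has at most one $a$-bracket per agent $a$; (b) no $a$-child is an $a$-parent. All cross-sequents are proper. $\iota(\Delta)=\bigvee\Delta$, $\iota(\mathcal{S},[\mathcal{S}_1|\dots|\mathcal{S}_m]_a)=\iota(\mathcal{S})\vee\bigvee_j\Box_a\iota(\mathcal{S}_j)$.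 The $a$-cluster $[\Gamma]_a$ of a component $\Gamma$ is $\Gamma$ together with its $a$-parent, $a$-siblings and $a$-children. A labeling assigns distinct nonnegative integers to components (root $0$). An interpretation of labeled $\mathcal{S}$ into $\mathcal{M}$ maps a superset of the labels into $W$ so that $\Delta\in[\Gamma]_a$ implies $[\ell(\Gamma)]R_a[\ell(\Delta)]$; $\mathcal{M},[\cdot]\vDash\mathcal{S}$ iff some formula of some component $\Gamma$ is true at $[\ell(\Gamma)]$; $\mathcal{S}$ is valid iff this holds for all models and interpretations. Calculus $\sharp{\sf S5}_n$. $\mathcal{S}\{X\}$ denotes a cross-sequent with a hole filled by $X$; writing $\psi,\mathcal{T}$ for a cross-sequent $\mathcal{T}$ means $\psi$ is added to the root component of $\mathcal{T}$. Rules (premises / conclusion; all cross-sequents must be proper): axioms $\mathrm{id}$: $\mathcal{S}\{p,\neg p\}$ and $\top$: $\mathcal{S}\{\top\}$; $\vee$: $\mathcal{S}\{\phi\vee\psi,\phi,\psi\}\,/\,\mathcal{S}\{\phi\vee\psi\}$; $\wedge$: $\mathcal{S}\{\phi\wedge\psi,\phi\}$ and $\mathcal{S}\{\phi\wedge\psi,\psi\}\,/\,\mathcal{S}\{\phi\wedge\psi\}$; $\Box\in a$: $\mathcal{S}\{[\phi\mid\Box_a\phi,\mathcal{T}\mid H]_a\}\,/\,\mathcal{S}\{[\Box_a\phi,\mathcal{T}\mid H]_a\}$ (here $H$ may be empty); $\Box\nearrow a$: $\mathcal{S}\{\Box_a\phi,[\phi\mid H]_a\}\,/\,\mathcal{S}\{\Box_a\phi,[H]_a\}$;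 $\Box\not\rightsquigarrow a$: $\mathcal{S}\{\Box_a\phi,[\phi]_a\}\,/\,\mathcal{S}\{\Box_a\phi\}$, provided the component of $\Box_a\phi$ has no $a$-children; $\Diamond\in a$: $\mathcal{S}\{[\Diamond_a\phi,\mathcal{T}\mid\phi,\mathcal{U}\mid H]_a\}\,/\,\mathcal{S}\{[\Diamond_a\phi,\mathcal{T}\mid\mathcal{U}\mid H]_a\}$; $\Diamond\nearrow a$: $\mathcal{S}\{\Diamond_a\phi,[\phi,\mathcal{T}\mid H]_a\}\,/\,\mathcal{S}\{\Diamond_a\phi,[\mathcal{T}\mid H]_a\}$; $\Diamond Ta$: $\mathcal{S}\{\Diamond_a\phi,\phi\}\,/\,\mathcal{S}\{\Diamond_a\phi\}$; $\Diamond\searrow a$: $\mathcal{S}\{\phi,\mathcal{T},[\Diamond_a\phi,\mathcal{U}\mid H]_a\}\,/\,\mathcal{S}\{\mathcal{T},[\Diamond_a\phi,\mathcal{U}\mid H]_a\}$. $\vdash_{\sharp{\sf S5}_n}\mathcal{S}$ means there is a finite proof tree with root $\mathcal{S}$ whose leaves are axioms. -}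

module Defs where

open import Data.Nat using (ℕ)
open import Data.Fin using (Fin)
open import Data.List using (List; []; _∷_; _++_; map)
open import Data.List.Relation.Unary.All using (All)
open import Data.List.Relation.Unary.Unique.Propositional using (Unique)
open import Data.List.Membership.Propositional using (_∈_)
open import Data.Product using (Σ; _×_; _,_; proj₁; proj₂)
open import Data.Sum using (_⊎_)
open import Data.Empty using (⊥)
open import Data.Unit using (⊤)
open import Relation.Nullary using (¬_)
open import Relation.Binary.PropositionalEquality using (_≡_; _≢_)
open import Relation.Binary.Structures using (IsEquivalence)

Agent : ℕ → Set
Agent n = Fin n

-- Formulas in negation normal form.
data Fm (n : ℕ) : Set where
  ⊥' ⊤'     : Fm n
  at nat    : ℕ → Fm n                 -- p and ¬p
  _∧'_ _∨'_ : Fm n → Fm n → Fm n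
  □ ◇       : Agent n → Fm n → Fm n

-- Cross-sequents: a root component (a finite set of formulas, represented
-- by a list; only membership matters) together with a list of brackets
-- [H]_a, each an agent with a hypersequent H (a finite multiset of
-- cross-sequents, represented by a list).

data CS (n : ℕ) : Set where
  node : List (Fm n) → List (Agent n × List (CS n)) → CS n

module _ {n : ℕ} where

  root : CS n → List (Fm n)
  root (node Γ _) = Γ

  brackets : CS n → List (Agent n × List (CS n))
  brackets (node _ bs) = bs

  addRoot : Fm n → CS n → CS n
  addRoot ψ (node Γ bs) = node (ψ ∷ Γ) bs

  single : Fm n → CS n
  single φ = node (φ ∷ []) []

  -- Well-formedness: hypersequents are nonempty (m ≥ 1), and properness
  -- (a) at most one a-bracket per agent in each component,
  -- (b) no a-child is an a-parent.

  data Proper : CS n → Set where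
    proper : ∀ {Γ bs} →
      Unique (map proj₁ bs) →
      All (λ b → (¬ (proj₂ b ≡ [])) ×
                 All (λ T → Proper T × All (λ b' → proj₁ b' ≢ proj₁ b) (brackets T))
                     (proj₂ b)) bs →
      Proper (node Γ bs)

  -- Contexts S{ } : a cross-sequent with a hole in place of a subtree.

  data Ctx : Set where
    top    : Ctx
    inside : List (Fm n) → List (Agent n × List (CS n)) → Agent n →
             List (CS n) → Ctx → List (CS n) →
             List (Agent n × List (CS n)) → Ctx

  plug : Ctx → CS n → CS n
  plug top T = T
  plug (inside Γ bs₁ a H₁ C H₂ bs₂) T =
    node Γ (bs₁ ++ (a , H₁ ++ plug C T ∷ H₂) ∷ bs₂)

  -- Local rule steps (premises, conclusion) acting on the subtree whose
  -- root is the active component.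

  data Step : List (CS n) → CS n → Set where
    id-ax : ∀ {Γ bs p} → at p ∈ Γ → nat p ∈ Γ → Step [] (node Γ bs)
    ⊤-ax  : ∀ {Γ bs} → ⊤' ∈ Γ → Step [] (node Γ bs)
    ∨-rule : ∀ {Γ bs φ ψ} → (φ ∨' ψ) ∈ Γ →
      Step (node (φ ∷ ψ ∷ Γ) bs ∷ []) (node Γ bs)
    ∧-rule : ∀ {Γ bs φ ψ} → (φ ∧' ψ) ∈ Γ →
      Step (node (φ ∷ Γ) bs ∷ node (ψ ∷ Γ) bs ∷ []) (node Γ bs)
    □∈ : ∀ {Γ bs₁ bs₂ a H₁ T H₂ φ} → □ a φ ∈ root T →
      Step (node Γ (bs₁ ++ (a , single φ ∷ H₁ ++ T ∷ H₂) ∷ bs₂) ∷ [])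
           (node Γ (bs₁ ++ (a , H₁ ++ T ∷ H₂) ∷ bs₂))
    □↗ : ∀ {Γ bs₁ bs₂ a H φ} → □ a φ ∈ Γ →
      Step (node Γ (bs₁ ++ (a , single φ ∷ H) ∷ bs₂) ∷ [])
           (node Γ (bs₁ ++ (a , H) ∷ bs₂))
    □↝̸ : ∀ {Γ bs a φ} → □ a φ ∈ Γ → All (λ b → proj₁ b ≢ a) bs →
      Step (node Γ (bs ++ (a , single φ ∷ []) ∷ []) ∷ []) (node Γ bs)
    -- ◇∈a (two list orders of the two distinct siblings)
    ◇∈₁ : ∀ {Γ bs₁ bs₂ a H₁ T H₂ U H₃ φ} → ◇ a φ ∈ root T →
      Step (node Γ (bs₁ ++ (a , H₁ ++ T ∷ H₂ ++ addRoot φ U ∷ H₃) ∷ bs₂) ∷ [])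
           (node Γ (bs₁ ++ (a , H₁ ++ T ∷ H₂ ++ U ∷ H₃) ∷ bs₂))
    ◇∈₂ : ∀ {Γ bs₁ bs₂ a H₁ T H₂ U H₃ φ} → ◇ a φ ∈ root T →
      Step (node Γ (bs₁ ++ (a , H₁ ++ addRoot φ U ∷ H₂ ++ T ∷ H₃) ∷ bs₂) ∷ [])
           (node Γ (bs₁ ++ (a , H₁ ++ U ∷ H₂ ++ T ∷ H₃) ∷ bs₂))
    ◇↗ : ∀ {Γ bs₁ bs₂ a H₁ T H₂ φ} → ◇ a φ ∈ Γ →
      Step (node Γ (bs₁ ++ (a , H₁ ++ addRoot φ T ∷ H₂) ∷ bs₂) ∷ [])
           (node Γ (bs₁ ++ (a , H₁ ++ T ∷ H₂) ∷ bs₂))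
    ◇T : ∀ {Γ bs a φ} → ◇ a φ ∈ Γ →
      Step (node (φ ∷ Γ) bs ∷ []) (node Γ bs)
    ◇↘ : ∀ {Γ bs₁ bs₂ a H₁ T H₂ φ} → ◇ a φ ∈ root T →
      Step (node (φ ∷ Γ) (bs₁ ++ (a , H₁ ++ T ∷ H₂) ∷ bs₂) ∷ [])
           (node Γ (bs₁ ++ (a , H₁ ++ T ∷ H₂) ∷ bs₂))

  data Rule : List (CS n) → CS n → Set where
    rule : ∀ {ps c} (C : Ctx) → Step ps c → Rule (map (plug C) ps) (plug C c)

  RuleInst : List (CS n) → CS n → Set
  RuleInst ps c = Rule ps c × All Proper ps × Proper c

  data ⊢_ : CS n → Set where
    der : ∀ {ps c} → Rule ps c → All Proper ps → Proper c →
          All ⊢_ ps → ⊢ c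

  ⋁ : List (Fm n) → Fm n
  ⋁ [] = ⊥'
  ⋁ (φ ∷ []) = φ
  ⋁ (φ ∷ ψ ∷ Δ) = φ ∨' ⋁ (ψ ∷ Δ)

  mutual
    ι : CS n → Fm n
    ι (node Γ bs) = ⋁ (Γ ++ boxes bs)

    boxes : List (Agent n × List (CS n)) → List (Fm n)
    boxes [] = []
    boxes ((a , H) ∷ bs) = boxesH a H ++ boxes bs

    boxesH : Agent n → List (CS n) → List (Fm n)
    boxesH a [] = []
    boxesH a (T ∷ H) = □ a (ι T) ∷ boxesH a H

record Model (n : ℕ) : Set₁ where
  field
    W         : Set
    inhabited : W
    R         : Agent n → W → W → Set
    R-equiv   : ∀ a → IsEquivalence (R a)
    V         : ℕ → W → Set

module _ {n : ℕ} where
  open Model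

  sat : (M : Model n) → W M → Fm n → Set
  sat M w ⊥' = ⊥
  sat M w ⊤' = ⊤
  sat M w (at p) = V M p w
  sat M w (nat p) = ¬ V M p w
  sat M w (φ ∧' ψ) = sat M w φ × sat M w ψ
  sat M w (φ ∨' ψ) = sat M w φ ⊎ sat M w ψ
  sat M w (□ a φ) = ∀ v → R M a w v → sat M v φ
  sat M w (◇ a φ) = Σ (W M) λ v → R M a w v × sat M v φ

  _∈S5 : Fm n → Set₁
  φ ∈S5 = (M : Model n) (w : W M) → sat M w φ

  -- Components of a cross-sequent (positions in the tree).
  data Pos : CS n → Set where
    here  : ∀ {Γ bs} → Pos (node Γ bs)
    there : ∀ {Γ bs a H T} → (a , H) ∈ bs → T ∈ H → Pos T → Pos (node Γ bs)

  comp : ∀ {S} → Pos S → List (Fm n)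
  comp (here {Γ}) = Γ
  comp (there _ _ p) = comp p

  data Child (a : Agent n) : {S : CS n} → Pos S → Pos S → Set where
    now   : ∀ {Γ bs H Γ' bs'} (b : (a , H) ∈ bs) (t : node Γ' bs' ∈ H) →
            Child a (here {Γ} {bs}) (there b t here)
    later : ∀ {Γ bs a' H T} (b : (a' , H) ∈ bs) (t : T ∈ H) {p q : Pos T} →
            Child a p q → Child a (there {Γ} b t p) (there b t q)

  InCluster : ∀ {S} → Agent n → Pos S → Pos S → Set
  InCluster {S} a p q =
    p ≡ q ⊎ Child a q p ⊎ Child a p q ⊎
    Σ (Pos S) (λ r → Child a r p × Child a r q)

  Valid : CS n → Set₁
  Valid S = (M : Model n) (f : Pos S → W M) →
    (∀ a (p q : Pos S) → InCluster a p q → R M a (f p) (f q)) →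
    Σ (Pos S) λ p → Σ (Fm n) λ φ → φ ∈ comp p × sat M (f p) φ

{-# OPTIONS --safe #-}
-- A refutation of a cross-sequent at a world w places its root at w and
-- each a-child of a component at an R_a-successor of that component's
-- world, so that every formula is false where its component sits;
-- classically, a cross-sequent is valid iff no model refutes it. Every
-- rule reflects refutations: from a refutation of the conclusion we read
-- off one of some premise. A false □_a φ supplies the world for a new
-- child {φ}, and a false ◇_a φ makes φ false throughout the a-cluster,
-- since R_a is an equivalence. Derivations are then sound by induction,
-- and a world falsifying ι S is the root of a refutation of S.
module Submission where

open import Defs
open import Level using (Level; 0ℓ)
open import Axiom.ExcludedMiddle using (ExcludedMiddle)
open import Axiom.DoubleNegationElimination using (em⇒dne)
open import Data.Nat using (ℕ; _≤_)
open import Data.List using (List; []; _∷_; _++_)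
open import Data.List.Relation.Unary.All using (All; []; _∷_; lookup; lookupAny; tabulate)
open import Data.List.Relation.Unary.All.Properties using (++⁺; ++⁻; map⁻)
open import Data.List.Relation.Unary.Any using (Any; here; there)
open import Data.List.Membership.Propositional using (_∈_)
open import Data.List.Membership.Propositional.Properties using (∈-++⁺ˡ; ∈-++⁺ʳ)
open import Data.Product using (Σ; _×_; _,_; proj₁; proj₂; map₂)
open import Data.Sum using (inj₁; inj₂)
open import Data.Empty using (⊥-elim)
open import Data.Unit using (tt)
open import Function using (id; _∘_)
open import Relation.Nullary using (¬_; yes; no)
open import Relation.Binary.PropositionalEquality using (refl)
open import Relation.Binary.Structures using (IsEquivalence)

module _ {A : Set} {P : A → Set} where

  All-focus : ∀ xs {x ys} → All P (xs ++ x ∷ ys) →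
    P x × (∀ {y} → P y → All P (xs ++ y ∷ ys))
  All-focus xs pxs with ++⁻ xs pxs
  ... | pxs₁ , px ∷ pxs₂ = px , λ py → ++⁺ pxs₁ (py ∷ pxs₂)

  All-focus₂ : ∀ xs {x} ys {z zs} → All P (xs ++ x ∷ ys ++ z ∷ zs) →
    P x × P z × (∀ {x′ z′} → P x′ → P z′ → All P (xs ++ x′ ∷ ys ++ z′ ∷ zs))
  All-focus₂ xs ys pxs with ++⁻ xs pxs
  ... | pxs₁ , px ∷ pxs₂ with All-focus ys pxs₂
  ... | pz , fillz = px , pz , λ px′ pz′ → ++⁺ pxs₁ (px′ ∷ fillz pz′)

module _ {n : ℕ} {ℓ : Level} (P : CS n → Set ℓ)
         (step : ∀ Γ bs → (∀ {a H T} → (a , H) ∈ bs → T ∈ H → P T) → P (node Γ bs))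
         where

  mutual
    CS-ind : ∀ S → P S
    CS-ind (node Γ bs) = step Γ bs (brackets-ind bs)

    brackets-ind : ∀ bs {a H T} → (a , H) ∈ bs → T ∈ H → P T
    brackets-ind ((_ , H) ∷ _)  (here refl) t = hypersequent-ind H t
    brackets-ind (_ ∷ bs)       (there b)   t = brackets-ind bs b t

    hypersequent-ind : ∀ H {T} → T ∈ H → P T
    hypersequent-ind (T ∷ _) (here refl) = CS-ind T
    hypersequent-ind (_ ∷ H) (there t)   = hypersequent-ind H t

module _ {n : ℕ} where

  ∈-boxesH : ∀ {a} {H : List (CS n)} {T} → T ∈ H → □ a (ι T) ∈ boxesH a H
  ∈-boxesH (here refl) = here refl
  ∈-boxesH (there t)   = there (∈-boxesH t)

  ∈-boxes : ∀ {bs : List (Agent n × List (CS n))} {a H T} →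
    (a , H) ∈ bs → T ∈ H → □ a (ι T) ∈ boxes bs
  ∈-boxes               (here refl) t = ∈-++⁺ˡ (∈-boxesH t)
  ∈-boxes {(a , H) ∷ _} (there b)   t = ∈-++⁺ʳ (boxesH a H) (∈-boxes b t)

rootPos : ∀ {n} (S : CS n) → Pos S
rootPos (node _ _) = here

child-root : ∀ {n} {Γ : List (Fm n)} {bs a H T} (b : (a , H) ∈ bs) (t : T ∈ H) →
  Child a (here {Γ = Γ}) (there b t (rootPos T))
child-root {T = node _ _} b t = now b t

module Soundness (n : ℕ) (em : ExcludedMiddle 0ℓ) where

  dne : {P : Set} → ¬ ¬ P → P
  dne = em⇒dne em

  module Refutations (M : Model n) where
    open Model M

    private module Equivalence {a : Agent n} = IsEquivalence (R-equiv a)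
    open Equivalence using () renaming (refl to R-refl; sym to R-sym; trans to R-trans)

    cluster-closed : ∀ {S} (f : Pos S → W) → (∀ {a p q} → Child a p q → R a (f p) (f q)) →
      ∀ a p q → InCluster a p q → R a (f p) (f q)
    cluster-closed f child a p q (inj₁ refl)                        = R-refl
    cluster-closed f child a p q (inj₂ (inj₁ c))                    = R-sym (child c)
    cluster-closed f child a p q (inj₂ (inj₂ (inj₁ c)))             = child c
    cluster-closed f child a p q (inj₂ (inj₂ (inj₂ (_ , c , c′)))) = R-trans (R-sym (child c)) (child c′)

    ¬□⇒◇¬ : ∀ {w a φ} → ¬ sat M w (□ a φ) → Σ W λ v → R a w v × ¬ sat M v φ
    ¬□⇒◇¬ ¬□ = dne λ ¬◇¬ → ¬□ λ v r → dne λ ¬φ → ¬◇¬ (v , r , ¬φ)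

    AllFalse : W → List (Fm n) → Set
    AllFalse w Γ = All (λ φ → ¬ sat M w φ) Γ

    data Refutation (w : W) : CS n → Set

    RefutedChild : W → Agent n → CS n → Set
    RefutedChild w a T = Σ W λ v → R a w v × Refutation v T

    RefutedBracket : W → Agent n × List (CS n) → Set
    RefutedBracket w b = All (RefutedChild w (proj₁ b)) (proj₂ b)

    data Refutation w where
      refutation : ∀ {Γ bs} → AllFalse w Γ → All (RefutedBracket w) bs → Refutation w (node Γ bs)

    rootFalse : ∀ {w S} → Refutation w S → AllFalse w (root S)
    rootFalse (refutation F _) = F

    lookupChild : ∀ {w Γ bs a H T} → Refutation w (node Γ bs) →
      (a , H) ∈ bs → T ∈ H → RefutedChild w a T
    lookupChild (refutation _ B) b t = lookup (lookup B b) t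

    focusBracket : ∀ {w Γ a H bs₂} bs₁ → Refutation w (node Γ (bs₁ ++ (a , H) ∷ bs₂)) →
      All (RefutedChild w a) H ×
      (∀ {H′} → All (RefutedChild w a) H′ → Refutation w (node Γ (bs₁ ++ (a , H′) ∷ bs₂)))
    focusBracket bs₁ (refutation F B) with All-focus bs₁ B
    ... | ρH , fill = ρH , refutation F ∘ fill

    worldOf : ∀ {w S} → Refutation w S → Pos S → W
    worldOf {w} _ here          = w
    worldOf ρ   (there b t p) = worldOf (proj₂ (proj₂ (lookupChild ρ b t))) p

    worldOf-child : ∀ {w S} (ρ : Refutation w S) {a p q} → Child a p q →
      R a (worldOf ρ p) (worldOf ρ q)
    worldOf-child ρ (now b t)     = proj₁ (proj₂ (lookupChild ρ b t))
    worldOf-child ρ (later b t c) = worldOf-child (proj₂ (proj₂ (lookupChild ρ b t))) c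

    worldOf-false : ∀ {w S} (ρ : Refutation w S) (p : Pos S) → AllFalse (worldOf ρ p) (comp p)
    worldOf-false ρ here          = rootFalse ρ
    worldOf-false ρ (there b t p) = worldOf-false (proj₂ (proj₂ (lookupChild ρ b t))) p

    Valid⇒¬Refutation : ∀ {w S} → Valid S → ¬ Refutation w S
    Valid⇒¬Refutation valid ρ
      with valid M (worldOf ρ) (cluster-closed (worldOf ρ) (worldOf-child ρ))
    ... | p , _ , i , s = lookup (worldOf-false ρ p) i s

    refutation-from : ∀ S (f : Pos S → W) → (∀ {a p q} → Child a p q → R a (f p) (f q)) →
      (∀ p → AllFalse (f p) (comp p)) → Refutation (f (rootPos S)) S
    refutation-from = CS-ind _ λ Γ bs ih f child false →
      refutation (false here) (tabulate λ b → tabulate λ t →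
        f (there b t (rootPos _)) , child (child-root b t) ,
        ih b t (f ∘ there b t) (child ∘ later b t) (false ∘ there b t))

    addRoot-refutation : ∀ {w φ T} → ¬ sat M w φ → Refutation w T → Refutation w (addRoot φ T)
    addRoot-refutation ¬φ (refutation F B) = refutation (¬φ ∷ F) B

    □-child : ∀ {w a φ} → ¬ sat M w (□ a φ) → RefutedChild w a (single φ)
    □-child {φ = φ} ¬□ with ¬□⇒◇¬ {φ = φ} ¬□
    ... | v , r , ¬φ = v , r , refutation (¬φ ∷ []) []

    □-sibling : ∀ {w a φ T} → RefutedChild w a T → □ a φ ∈ root T → RefutedChild w a (single φ)
    □-sibling (v , r , ρT) i with □-child (lookup (rootFalse ρT) i)
    ... | u , r′ , ρφ = u , R-trans r r′ , ρφ

    ◇-child : ∀ {w a φ T} → ¬ sat M w (◇ a φ) → RefutedChild w a T →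
      RefutedChild w a (addRoot φ T)
    ◇-child ¬◇ (v , r , ρT) = v , r , addRoot-refutation (λ φ → ¬◇ (v , r , φ)) ρT

    ◇-sibling : ∀ {w a φ T U} → RefutedChild w a T → ◇ a φ ∈ root T →
      RefutedChild w a U → RefutedChild w a (addRoot φ U)
    ◇-sibling (v , r , ρT) i (u , r′ , ρU) =
      u , r′ , addRoot-refutation (λ φ → lookup (rootFalse ρT) i (u , R-trans (R-sym r) r′ , φ)) ρU

    ◇-parent : ∀ {w a φ T} → RefutedChild w a T → ◇ a φ ∈ root T → ¬ sat M w φ
    ◇-parent (_ , r , ρT) i φ = lookup (rootFalse ρT) i (_ , R-sym r , φ)

    refuted-premise : ∀ {w ps c} → Step ps c → Refutation w c → Any (Refutation w) ps
    refuted-premise (id-ax i j) (refutation F _) = ⊥-elim (lookup F j (lookup F i))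
    refuted-premise (⊤-ax i)    (refutation F _) = ⊥-elim (lookup F i tt)
    refuted-premise (∨-rule i)  (refutation F B) =
      here (refutation (lookup F i ∘ inj₁ ∷ lookup F i ∘ inj₂ ∷ F) B)
    refuted-premise {w} (∧-rule {φ = φ} i) (refutation F B) with em {sat M w φ}
    ... | yes φ-true = there (here (refutation (lookup F i ∘ (φ-true ,_) ∷ F) B))
    ... | no  φ-false = here (refutation (φ-false ∷ F) B)
    refuted-premise (□∈ {bs₁ = bs₁} {H₁ = H₁} i) ρ with focusBracket bs₁ ρ
    ... | ρH , fill = here (fill (□-sibling (proj₁ (All-focus H₁ ρH)) i ∷ ρH))
    refuted-premise (□↗ {bs₁ = bs₁} i) ρ with focusBracket bs₁ ρ
    ... | ρH , fill = here (fill (□-child (lookup (rootFalse ρ) i) ∷ ρH))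
    refuted-premise (□↝̸ i _) (refutation F B) =
      here (refutation F (++⁺ B ((□-child (lookup F i) ∷ []) ∷ [])))
    refuted-premise (◇∈₁ {bs₁ = bs₁} {H₁ = H₁} {H₂ = H₂} i) ρ with focusBracket bs₁ ρ
    ... | ρH , fill with All-focus₂ H₁ H₂ ρH
    ... | ρT , ρU , fill₂ = here (fill (fill₂ ρT (◇-sibling ρT i ρU)))
    refuted-premise (◇∈₂ {bs₁ = bs₁} {H₁ = H₁} {H₂ = H₂} i) ρ with focusBracket bs₁ ρ
    ... | ρH , fill with All-focus₂ H₁ H₂ ρH
    ... | ρU , ρT , fill₂ = here (fill (fill₂ (◇-sibling ρT i ρU) ρT))
    refuted-premise (◇↗ {bs₁ = bs₁} {H₁ = H₁} i) ρ with focusBracket bs₁ ρ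
    ... | ρH , fill with All-focus H₁ ρH
    ... | ρT , fill₁ = here (fill (fill₁ (◇-child (lookup (rootFalse ρ) i) ρT)))
    refuted-premise (◇T i) (refutation F B) =
      here (refutation ((λ φ → lookup F i (_ , R-refl , φ)) ∷ F) B)
    refuted-premise (◇↘ {bs₁ = bs₁} {H₁ = H₁} i) ρ@(refutation F B) =
      here (refutation (◇-parent (proj₁ (All-focus H₁ (proj₁ (focusBracket bs₁ ρ)))) i ∷ F) B)

    unplug : ∀ C {w T} → Refutation w (plug C T) →
      Σ W λ v → Refutation v T × (∀ {T′} → Refutation v T′ → Refutation w (plug C T′))
    unplug top ρ = _ , ρ , id
    unplug (inside _ bs₁ _ H₁ C _ _) ρ with focusBracket bs₁ ρ
    ... | ρH , fill with All-focus H₁ ρH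
    ... | (v , r , ρC) , fill₁ with unplug C ρC
    ... | u , ρT , fillT = u , ρT , λ ρ′ → fill (fill₁ (v , r , fillT ρ′))

    ⋁-false : ∀ {w L} → ¬ sat M w (⋁ L) → AllFalse w L
    ⋁-false {L = []}        _   = []
    ⋁-false {L = _ ∷ []}    ¬φ  = ¬φ ∷ []
    ⋁-false {L = _ ∷ _ ∷ _} ¬∨ = ¬∨ ∘ inj₁ ∷ ⋁-false (¬∨ ∘ inj₂)

    ι-refutation : ∀ S {w} → ¬ sat M w (ι S) → Refutation w S
    ι-refutation = CS-ind _ λ Γ bs ih ¬ι →
      let false = ⋁-false ¬ι
      in refutation (proj₁ (++⁻ Γ false)) (tabulate λ b → tabulate λ {T} t →
           map₂ (map₂ (ih b t)) (¬□⇒◇¬ {φ = ι T} (lookup false (∈-++⁺ʳ Γ (∈-boxes b t)))))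

  open Refutations

  ¬Refutation⇒Valid : ∀ {S : CS n} → (∀ M w → ¬ Refutation M w S) → Valid S
  ¬Refutation⇒Valid {S} unrefuted M f cluster = dne λ nothing-true →
    unrefuted M _ (refutation-from M S f (cluster _ _ _ ∘ inj₂ ∘ inj₂ ∘ inj₁)
                                         (λ p → tabulate λ i φ → nothing-true (p , _ , i , φ)))

  Rule-sound : ∀ {ps : List (CS n)} {c} → Rule ps c → All Valid ps → Valid c
  Rule-sound (rule C step) valid = ¬Refutation⇒Valid λ M w ρ →
    let (v , ρT , fill) = unplug M C ρ
        (valid-premise , ρ-premise) = lookupAny (map⁻ valid) (refuted-premise M step ρT)
    in Valid⇒¬Refutation M valid-premise (fill ρ-premise)

  mutual
    derivable⇒Valid : ∀ {S : CS n} → ⊢ S → Valid S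
    derivable⇒Valid (der r _ _ ds) = Rule-sound r (all-derivable⇒Valid ds)

    all-derivable⇒Valid : ∀ {ps : List (CS n)} → All ⊢_ ps → All Valid ps
    all-derivable⇒Valid []       = []
    all-derivable⇒Valid (d ∷ ds) = derivable⇒Valid d ∷ all-derivable⇒Valid ds

  Valid⇒ι∈S5 : ∀ S → Valid S → ι S ∈S5
  Valid⇒ι∈S5 S valid M w = dne λ ¬ι → Valid⇒¬Refutation M valid (ι-refutation M S ¬ι)

lemma2 : (n : ℕ) → 1 ≤ n → ExcludedMiddle 0ℓ →
    ((∀ {ps : List (CS n)} {c : CS n} → RuleInst ps c → All Valid ps → Valid c)
    × (∀ (S : CS n) → Proper S → ⊢ S → Valid S)
    × (∀ (S : CS n) → Proper S → ⊢ S → ι S ∈S5))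
lemma2 n _ em =
  Rule-sound ∘ proj₁ ,
  (λ _ _ → derivable⇒Valid) ,
  (λ S _ → Valid⇒ι∈S5 S ∘ derivable⇒Valid)
  where open Soundness n em
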